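{- Let $t\geq 3$ and let $\boldsymbol{R}$ be the symmetric $2t$-cycle in $\boldsymbol{H}(t,2)$ given by $R^0=\mathrm{T}^{(+)}$, $R^s={}_{ -[s]}R^0$ for $1\leq s\leq t-1$, and $R^{k+t}=-R^k$ for $0\leq k\leq t-1$. Let $A$ and $B$ be two nonempty subsets of $E_t=\{1,\ldots,t\}$, with partitions into intervals $A=[i'_1,j'_1]\,\dot\cup\cdots\dot\cup\,[i'_{\varrho(A)},j'_{\varrho(A)}]$ and $B=[i''_1,j''_1]\,\dot\cup\cdots\dot\cup\,[i''_{\varrho(B)},j''_{\varrho(B)}]$ (with $i'_k\leq j'_k$, $i''_k\leq j''_k$) such that $j'_k+2\leq i'_{k+1}$ for $1\leq k\leq\varrho(A)-1$ and $j''_k+2\leq i''_{k+1}$ for $1\leq k\leq \varrho(B)-1$. \begin{itemize} \item[(i)] If $|\{1,t\}\cap A|>0$ and $|\{1,t\}\cap B|>0$, or if $|\{1,t\}\cap A|=|\{1,t\}\cap B|=0$, then $|\boldsymbol{Q}({}_{ -A}\mathrm{T}^{(+)},\boldsymbol{R})|=|\boldsymbol{Q}({}_{ -B}\mathrm{T}^{(+)},\boldsymbol{R})|$ if and only if $\varrho(B)=\varrho(A)$. \item[(ii)] If $|\{1,t\}\cap A|>0$ and $|\{1,t\}\cap B|=0$, then $|\boldsymbol{Q}({}_{ -A}\mathrm{T}^{(+)},\boldsymbol{R})|=|\boldsymbol{Q}({}_{ -B}\mathrm{T}^{(+)},\boldsymbol{R})|$ if and only if $\varrho(B)=\varrho(A)-1$.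 \end{itemize}
   Context: Let $t\geq 3$ be an integer, $E_t=[t]=\{1,\ldots,t\}$, and $[a,b]=\{a,\ldots,b\}$ for integers $a\leq b$. The hypercube graph $\boldsymbol{H}(t,2)$ has vertex set $\{1,-1\}^t$ (topes), row vectors $T=(T(1),\ldots,T(t))$; vertices are adjacent iff they differ in exactly one coordinate. $\mathrm{T}^{(+)}=(1,\ldots,1)$. For $A\subseteq E_t$, ${}_{ -A}T$ is obtained from $T$ by negating the coordinates indexed by $A$. Let $\mathbf{M}$ be the (nonsingular) $t\times t$ matrix with rows $R^0,\ldots,R^{t-1}$, and $\boldsymbol{x}(T,\boldsymbol{R})=T\mathbf{M}^{ -1}\in\{ -1,0,1\}^t$. $\boldsymbol{Q}(T,\boldsymbol{R})$ is the unique inclusion-minimal subset of the vertex set of $\boldsymbol{R}$ whose sum is $T$ (known to exist and be unique); equivalently $\boldsymbol{Q}(T,\boldsymbol{R})=\{x_iR^{i-1}\colon x_i\neq 0\}$ for $(x_1,\ldots,x_t)=\boldsymbol{x}(T,\boldsymbol{R})$, so $|\boldsymbol{Q}(T,\boldsymbol{R})|$ is the number of nonzero entries of $\boldsymbol{x}(T,\boldsymbol{R})$. -}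

module Defs where

open import Data.Nat using (ℕ; zero; suc; _+_; _∸_; _≤_; _<_; _≤ᵇ_; _<ᵇ_)
open import Data.Bool using (Bool; true; false; if_then_else_; _∨_; _∧_)
open import Data.Integer using (ℤ; +_; -_; _*_) renaming (_+_ to _+ℤ_)
open import Relation.Binary.PropositionalEquality using (_≡_)
open import Relation.Nullary using (¬_)
open import Data.Product using (Σ; _×_)
open import Data.Sum using (_⊎_)

-- Conventions: coordinates of topes are indexed by c ∈ {1,…,t} (values of ℕ);
-- a tope / row vector is a function ℕ → ℤ (only coordinates 1..t matter).

sumFrom : ℕ → ℕ → (ℕ → ℤ) → ℤ
sumFrom a zero    f = + 0
sumFrom a (suc n) f = f a +ℤ sumFrom (suc a) n f

Tplus : ℕ → ℤ
Tplus c = + 1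

negOn : (ℕ → Bool) → (ℕ → ℤ) → (ℕ → ℤ)
negOn A T c = if A c then - T c else T c

initSeg : ℕ → ℕ → Bool
initSeg s c = c ≤ᵇ s    -- membership of c in [s] = [1,s] (for c ≥ 1)

Rbase : ℕ → ℕ → ℤ
Rbase s = negOn (initSeg s) Tplus

R : (t : ℕ) → ℕ → ℕ → ℤ
R t k c = if k <ᵇ t then Rbase k c else - Rbase (k ∸ t) c

-- x is a solution of x M = T, where M is the t×t matrix with rows R^0,…,R^{t-1};
-- x = (x_1,…,x_t) is indexed by 1..t, x_i multiplies row R^{i-1}.
SolvesXM : (t : ℕ) → (ℕ → ℤ) → (ℕ → ℤ) → Set
SolvesXM t T x = ∀ c → 1 ≤ c → c ≤ t →
  sumFrom 1 t (λ i → x i * R t (i ∸ 1) c) ≡ T c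

isNonzero : ℤ → Bool
isNonzero (+ zero) = false
isNonzero _        = true

countNZ : ℕ → ℕ → (ℕ → ℤ) → ℕ
countNZ a zero    x = 0
countNZ a (suc n) x = (if isNonzero (x a) then 1 else 0) + countNZ (suc a) n x

-- |Q(T,R)| = n : n is the number of nonzero entries of x(T,R) = T M^{-1}
-- (M is nonsingular, so x is the unique solution of x M = T).
QSize : (t : ℕ) → (ℕ → ℤ) → ℕ → Set
QSize t T n = Σ (ℕ → ℤ) λ x → SolvesXM t T x × countNZ 1 t x ≡ n

inIntervals : (ρ : ℕ) → (i j : ℕ → ℕ) → ℕ → Bool
inIntervals zero    i j c = false
inIntervals (suc r) i j c = inIntervals r i j c ∨ ((i (suc r) ≤ᵇ c) ∧ (c ≤ᵇ j (suc r)))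

IntervalPartition : (t ρ : ℕ) → (i j : ℕ → ℕ) → Set
IntervalPartition t ρ i j =
  (∀ k → 1 ≤ k → k ≤ ρ → 1 ≤ i k × i k ≤ j k × j k ≤ t) ×
  (∀ k → 1 ≤ k → k < ρ → j k + 2 ≤ i (suc k))

meetsEnds : (t : ℕ) → (ℕ → Bool) → Set
meetsEnds t A = (A 1 ≡ true) ⊎ (A t ≡ true)

module Submission where

-- Write T = _{-A}T^(+), so T(c) = -1 for c ∈ A and T(c) = 1 otherwise.
-- Row R^k (0 ≤ k < t) is -1 exactly on the coordinates 1,…,k, so the system x M = T is
-- solved by the "half jumps"
--     x_1 = (T(1) + T(t)) / 2,      x_i = (T(i) - T(i-1)) / 2   (2 ≤ i ≤ t):
-- for a coordinate c the sum  x_1 + Σ_{2≤i≤c} x_i - Σ_{c<i≤t} x_i  telescopes to T(c).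
-- Hence x_1 ≠ 0 iff A contains both or neither of 1, t, and x_i ≠ 0 (i ≥ 2) iff A
-- changes membership between i-1 and i.  A union of ρ intervals separated by gaps of
-- length ≥ 1 changes membership exactly 2ρ times along 0,1,…,t+1; removing the changes
-- at the two ends gives |Q| = 2ρ - 1 when A meets {1,t} and |Q| = 2ρ + 1 otherwise.
-- Both parts of the theorem then follow by comparing these odd numbers.

open import Defs
open import Data.Nat
  using (ℕ; zero; suc; _+_; _*_; _∸_; _≤_; _<_; _≤ᵇ_; _<ᵇ_; _≡ᵇ_; z≤n; s≤s; z<s; _<?_)
open import Data.Nat.Properties
open import Data.Integer using (ℤ; +_; -_) renaming (_+_ to _+ℤ_; _-_ to _-ℤ_; _*_ to _*ℤ_)
import Data.Integer.Properties as ℤP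
open import Algebra.Properties.CommutativeSemigroup +-commutativeSemigroup
  using () renaming (interchange to +-interchange)
open import Data.Integer.Tactic.RingSolver using (solve-∀)
open import Data.Bool using (Bool; true; false; if_then_else_; _∨_; _∧_; _xor_; not)
open import Data.Bool.Properties using (T-≡; ¬-not; ∨-identityʳ; ∧-zeroʳ)
open import Data.Product using (Σ; _×_; _,_; proj₁; proj₂)
open import Data.Sum using (_⊎_; inj₁; inj₂)
open import Data.Empty using (⊥-elim)
open import Relation.Nullary using (¬_; yes; no)
open import Relation.Binary.PropositionalEquality
open import Relation.Binary.Definitions using (tri<; tri≈; tri>)
open import Function.Bundles using (_⇔_; mk⇔; Equivalence)
import Function.Properties.Equivalence as ⇔
open ≡-Reasoning

≤ᵇ-true : ∀ {m n} → m ≤ n → (m ≤ᵇ n) ≡ true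
≤ᵇ-true m≤n = Equivalence.to T-≡ (≤⇒≤ᵇ m≤n)

≤ᵇ-false : ∀ {m n} → n < m → (m ≤ᵇ n) ≡ false
≤ᵇ-false {m} {n} n<m = ¬-not (λ e → <⇒≱ n<m (≤ᵇ⇒≤ m n (Equivalence.from T-≡ e)))

<ᵇ-true : ∀ {m n} → m < n → (m <ᵇ n) ≡ true
<ᵇ-true m<n = Equivalence.to T-≡ (<⇒<ᵇ m<n)

≡ᵇ-true : ∀ n → (n ≡ᵇ n) ≡ true
≡ᵇ-true n = Equivalence.to T-≡ (≡⇒≡ᵇ n n refl)

≡ᵇ-false : ∀ {m n} → m ≢ n → (m ≡ᵇ n) ≡ false
≡ᵇ-false {m} {n} m≢n = ¬-not (λ e → m≢n (≡ᵇ⇒≡ m n (Equivalence.from T-≡ e)))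

sumFrom-cong : ∀ a n {f g : ℕ → ℤ} → (∀ i → a ≤ i → i < a + n → f i ≡ g i) →
               sumFrom a n f ≡ sumFrom a n g
sumFrom-cong a zero    f≡g = refl
sumFrom-cong a (suc n) f≡g =
  cong₂ _+ℤ_ (f≡g a ≤-refl (m<m+n a z<s))
             (sumFrom-cong (suc a) n (λ i a<i i<end →
               f≡g i (<⇒≤ a<i) (subst (i <_) (sym (+-suc a n)) i<end)))

sumFrom-split : ∀ a m n (f : ℕ → ℤ) →
                sumFrom a (m + n) f ≡ sumFrom a m f +ℤ sumFrom (a + m) n f
sumFrom-split a zero    n f =
  trans (cong (λ b → sumFrom b n f) (sym (+-identityʳ a))) (sym (ℤP.+-identityˡ _))
sumFrom-split a (suc m) n f = begin
  f a +ℤ sumFrom (suc a) (m + n) f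
    ≡⟨ cong (f a +ℤ_) (sumFrom-split (suc a) m n f) ⟩
  f a +ℤ (sumFrom (suc a) m f +ℤ sumFrom (suc a + m) n f)
    ≡⟨ sym (ℤP.+-assoc (f a) _ _) ⟩
  f a +ℤ sumFrom (suc a) m f +ℤ sumFrom (suc a + m) n f
    ≡⟨ cong (λ b → f a +ℤ sumFrom (suc a) m f +ℤ sumFrom b n f) (sym (+-suc a m)) ⟩
  f a +ℤ sumFrom (suc a) m f +ℤ sumFrom (a + suc m) n f ∎

sumFrom-neg : ∀ a n (f : ℕ → ℤ) → sumFrom a n (λ i → - f i) ≡ - sumFrom a n f
sumFrom-neg a zero    f = refl
sumFrom-neg a (suc n) f =
  trans (cong (- f a +ℤ_) (sumFrom-neg (suc a) n f)) (sym (ℤP.neg-distrib-+ (f a) _))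

sumFrom-scale : ∀ k a n (f : ℕ → ℤ) → k *ℤ sumFrom a n f ≡ sumFrom a n (λ i → k *ℤ f i)
sumFrom-scale k a zero    f = ℤP.*-zeroʳ k
sumFrom-scale k a (suc n) f =
  trans (ℤP.*-distribˡ-+ k (f a) _) (cong (k *ℤ f a +ℤ_) (sumFrom-scale k (suc a) n f))

telescope : ∀ (f g : ℕ → ℤ) a → (∀ i → a ≤ i → f (suc i) ≡ g (suc i) -ℤ g i) →
            ∀ n → sumFrom (suc a) n f ≡ g (a + n) -ℤ g a
telescope f g a step zero =
  trans (sym (ℤP.+-inverseʳ (g a))) (cong (λ b → g b -ℤ g a) (sym (+-identityʳ a)))
telescope f g a step (suc n) = begin
  f (suc a) +ℤ sumFrom (suc (suc a)) n f
    ≡⟨ cong₂ _+ℤ_ (step a ≤-refl)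
                  (telescope f g (suc a) (λ i a<i → step i (<⇒≤ a<i)) n) ⟩
  (g (suc a) -ℤ g a) +ℤ (g (suc a + n) -ℤ g (suc a))
    ≡⟨ cancel-middle (g a) (g (suc a)) (g (suc a + n)) ⟩
  g (suc a + n) -ℤ g a
    ≡⟨ cong (λ b → g b -ℤ g a) (sym (+-suc a n)) ⟩
  g (a + suc n) -ℤ g a ∎
  where
  cancel-middle : ∀ p q r → (q -ℤ p) +ℤ (r -ℤ q) ≡ r -ℤ p
  cancel-middle = solve-∀

-- (2) The explicit solution of x M = _{-A}T^(+).

jump : (ℕ → Bool) → ℕ → Bool
jump A d = A (suc d) xor A d

sign : Bool → ℤ
sign b = if b then - (+ 1) else + 1

-- The half jumps x_1 = (T(1) + T(t))/2 and x_i = (T(i) - T(i-1))/2 for i ≥ 2.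
solution : (ℕ → Bool) → ℕ → ℕ → ℤ
solution A t zero          = + 0
solution A t (suc zero)    = if A 1 xor A t then + 0 else sign (A 1)
solution A t (suc (suc d)) = if A (suc (suc d)) xor A (suc d) then sign (A (suc (suc d))) else + 0

solution-first : ∀ A t → + 2 *ℤ solution A t 1 ≡ negOn A Tplus 1 +ℤ negOn A Tplus t
solution-first A t with A 1 | A t
... | true  | true  = refl
... | true  | false = refl
... | false | true  = refl
... | false | false = refl

solution-step : ∀ A t i → 1 ≤ i →
                + 2 *ℤ solution A t (suc i) ≡ negOn A Tplus (suc i) -ℤ negOn A Tplus i
solution-step A t (suc d) _ with A (suc (suc d)) | A (suc d)
... | true  | true  = refl
... | true  | false = refl
... | false | true  = refl
... | false | false = refl

row-inside : ∀ {t k c} → k < t → c ≤ k → R t k c ≡ - (+ 1)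
row-inside k<t c≤k rewrite <ᵇ-true k<t | ≤ᵇ-true c≤k = refl

row-outside : ∀ {t k c} → k < t → k < c → R t k c ≡ + 1
row-outside k<t k<c rewrite <ᵇ-true k<t | ≤ᵇ-false k<c = refl

recombine : ∀ x s₁ s₂ a b c → + 2 *ℤ x ≡ a +ℤ b → + 2 *ℤ s₁ ≡ c -ℤ a → + 2 *ℤ s₂ ≡ b -ℤ c →
            + 2 *ℤ (x +ℤ (s₁ -ℤ s₂)) ≡ + 2 *ℤ c
recombine x s₁ s₂ a b c hx h₁ h₂ = begin
  + 2 *ℤ (x +ℤ (s₁ -ℤ s₂))              ≡⟨ distribute x s₁ s₂ ⟩
  + 2 *ℤ x +ℤ (+ 2 *ℤ s₁ -ℤ + 2 *ℤ s₂)  ≡⟨ cong₂ (λ u v → u +ℤ (v -ℤ + 2 *ℤ s₂)) hx h₁ ⟩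
  (a +ℤ b) +ℤ ((c -ℤ a) -ℤ + 2 *ℤ s₂)   ≡⟨ cong (λ w → (a +ℤ b) +ℤ ((c -ℤ a) -ℤ w)) h₂ ⟩
  (a +ℤ b) +ℤ ((c -ℤ a) -ℤ (b -ℤ c))    ≡⟨ collect a b c ⟩
  + 2 *ℤ c ∎
  where
  distribute : ∀ x s₁ s₂ → + 2 *ℤ (x +ℤ (s₁ -ℤ s₂)) ≡ + 2 *ℤ x +ℤ (+ 2 *ℤ s₁ -ℤ + 2 *ℤ s₂)
  distribute = solve-∀
  collect : ∀ a b c → (a +ℤ b) +ℤ ((c -ℤ a) -ℤ (b -ℤ c)) ≡ + 2 *ℤ c
  collect = solve-∀

pred-< : ∀ {i m} → i < suc (suc m) → i ∸ 1 < suc m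
pred-< i<m+2 = s≤s (∸-monoˡ-≤ 1 (≤-pred i<m+2))

-- The c-th equation reads x_1 + S₁ - S₂ = T(c), where S₁ sums x_i over the rows
-- R^1 … R^{c-1} (entry +1 at c) and S₂ over the rows R^c … R^{t-1} (entry -1 at c);
-- it is checked after multiplying by 2, where each part telescopes.
solution-solves : ∀ A t → SolvesXM t (negOn A Tplus) (solution A t)
solution-solves A (suc t') (suc c') _ (s≤s c'≤t') =
  ℤP.*-cancelˡ-≡ (+ 2) _ _
    (trans (cong (+ 2 *ℤ_) expand)
           (recombine (x 1) S₁ S₂ (T 1) (T t) (T c) (solution-first A t) S₁-telescopes S₂-telescopes))
  where
  t c : ℕ
  t = suc t'
  c = suc c'
  T x : ℕ → ℤ
  T = negOn A Tplus
  x = solution A t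
  g : ℕ → ℤ
  g i = x i *ℤ R t (i ∸ 1) c
  S₁ S₂ : ℤ
  S₁ = sumFrom 2 c' x
  S₂ = sumFrom (suc c) (t' ∸ c') x
  row-split : t' ≡ c' + (t' ∸ c')
  row-split = sym (m+[n∸m]≡n c'≤t')
  early : ∀ i → 2 ≤ i → i < 2 + c' → g i ≡ x i
  early i _ i<c+1 = trans (cong (x i *ℤ_) (row-outside (<-≤-trans (pred-< i<c+1) (s≤s c'≤t')) (pred-< i<c+1)))
                          (ℤP.*-identityʳ (x i))
  late : ∀ i → suc c ≤ i → i < suc c + (t' ∸ c') → g i ≡ - x i
  late i c<i i<t+1 =
    trans (cong (x i *ℤ_) (row-inside (subst (i ∸ 1 <_) (cong suc (sym row-split)) (pred-< i<t+1))
                                      (∸-monoˡ-≤ 1 c<i)))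
          (trans (ℤP.*-comm (x i) _) (ℤP.-1*i≡-i (x i)))
  expand : sumFrom 1 t g ≡ x 1 +ℤ (S₁ -ℤ S₂)
  expand = begin
    g 1 +ℤ sumFrom 2 t' g
      ≡⟨ cong₂ _+ℤ_ (trans (cong (x 1 *ℤ_) (row-outside {t} {0} {c} z<s z<s)) (ℤP.*-identityʳ (x 1)))
                    (cong (λ n → sumFrom 2 n g) row-split) ⟩
    x 1 +ℤ sumFrom 2 (c' + (t' ∸ c')) g
      ≡⟨ cong (x 1 +ℤ_) (sumFrom-split 2 c' (t' ∸ c') g) ⟩
    x 1 +ℤ (sumFrom 2 c' g +ℤ sumFrom (suc c) (t' ∸ c') g)
      ≡⟨ cong (x 1 +ℤ_) (cong₂ _+ℤ_ (sumFrom-cong 2 c' early)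
                                    (trans (sumFrom-cong (suc c) (t' ∸ c') late)
                                           (sumFrom-neg (suc c) (t' ∸ c') x))) ⟩
    x 1 +ℤ (S₁ -ℤ S₂) ∎
  S₁-telescopes : + 2 *ℤ S₁ ≡ T c -ℤ T 1
  S₁-telescopes = trans (sumFrom-scale (+ 2) 2 c' x)
                        (telescope (λ i → + 2 *ℤ x i) T 1 (solution-step A t) c')
  S₂-telescopes : + 2 *ℤ S₂ ≡ T t -ℤ T c
  S₂-telescopes =
    trans (sumFrom-scale (+ 2) (suc c) (t' ∸ c') x)
          (trans (telescope (λ i → + 2 *ℤ x i) T c (λ i c≤i → solution-step A t i (≤-trans z<s c≤i)) (t' ∸ c'))
                 (cong (λ b → T (suc b) -ℤ T c) (sym row-split)))

-- (3) Nonzero entries of the solution, counted as membership changes.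

b2n : Bool → ℕ
b2n b = if b then 1 else 0

sumℕ : ℕ → ℕ → (ℕ → ℕ) → ℕ
sumℕ a zero    f = 0
sumℕ a (suc n) f = f a + sumℕ (suc a) n f

jumps : ℕ → ℕ → (ℕ → Bool) → ℕ
jumps a n A = sumℕ a n (λ d → b2n (jump A d))

isNonzero-sign : ∀ b s → isNonzero (if b then sign s else + 0) ≡ b
isNonzero-sign false s     = refl
isNonzero-sign true  true  = refl
isNonzero-sign true  false = refl

isNonzero-sign-unless : ∀ b s → isNonzero (if b then + 0 else sign s) ≡ not b
isNonzero-sign-unless true  s     = refl
isNonzero-sign-unless false true  = refl
isNonzero-sign-unless false false = refl

nonzeros-solution : ∀ A t' → countNZ 1 (suc t') (solution A (suc t')) ≡
                    b2n (not (A 1 xor A (suc t'))) + jumps 1 t' A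
nonzeros-solution A t' =
  cong₂ _+_ (cong b2n (isNonzero-sign-unless (A 1 xor A (suc t')) (A 1))) (later 0 t')
  where
  later : ∀ a n → countNZ (suc (suc a)) n (solution A (suc t')) ≡ jumps (suc a) n A
  later a zero    = refl
  later a (suc n) =
    cong₂ _+_ (cong b2n (isNonzero-sign (jump A (suc a)) (A (suc (suc a))))) (later (suc a) n)

-- (4) Membership changes of a union of separated intervals.

sumℕ-cong : ∀ a n {f g : ℕ → ℕ} → (∀ d → f d ≡ g d) → sumℕ a n f ≡ sumℕ a n g
sumℕ-cong a zero    f≡g = refl
sumℕ-cong a (suc n) f≡g = cong₂ _+_ (f≡g a) (sumℕ-cong (suc a) n f≡g)

sumℕ-+ : ∀ a n (f g : ℕ → ℕ) → sumℕ a n (λ d → f d + g d) ≡ sumℕ a n f + sumℕ a n g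
sumℕ-+ a zero    f g = refl
sumℕ-+ a (suc n) f g =
  trans (cong (_+_ (f a + g a)) (sumℕ-+ (suc a) n f g))
        (+-interchange (f a) (g a) (sumℕ (suc a) n f) (sumℕ (suc a) n g))

sumℕ-snoc : ∀ a n (f : ℕ → ℕ) → sumℕ a (suc n) f ≡ sumℕ a n f + f (a + n)
sumℕ-snoc a zero    f = trans (+-identityʳ (f a)) (cong f (sym (+-identityʳ a)))
sumℕ-snoc a (suc n) f =
  trans (cong (_+_ (f a)) (sumℕ-snoc (suc a) n f))
        (trans (sym (+-assoc (f a) _ _)) (cong (λ b → f a + sumℕ (suc a) n f + f b) (sym (+-suc a n))))

indicator-before : ∀ a n k → k < a → sumℕ a n (λ d → b2n (d ≡ᵇ k)) ≡ 0
indicator-before a zero    k k<a = refl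
indicator-before a (suc n) k k<a =
  cong₂ _+_ (cong b2n (≡ᵇ-false (>⇒≢ k<a))) (indicator-before (suc a) n k (m≤n⇒m≤1+n k<a))

indicator-inside : ∀ a n k → a ≤ k → k < a + n → sumℕ a n (λ d → b2n (d ≡ᵇ k)) ≡ 1
indicator-inside a zero    k a≤k k<a+0 = ⊥-elim (<⇒≱ k<a+0 (subst (_≤ k) (sym (+-identityʳ a)) a≤k))
indicator-inside a (suc n) k a≤k k<end with <-cmp a k
... | tri< a<k _ _ = cong₂ _+_ (cong b2n (≡ᵇ-false (<⇒≢ a<k)))
                                (indicator-inside (suc a) n k a<k (subst (k <_) (+-suc a n) k<end))
... | tri≈ _ refl _ = cong₂ _+_ (cong b2n (≡ᵇ-true a)) (indicator-before (suc a) n a ≤-refl)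
... | tri> _ _ k<a = ⊥-elim (<⇒≱ k<a a≤k)

interval : ℕ → ℕ → ℕ → Bool
interval i j c = (i ≤ᵇ c) ∧ (c ≤ᵇ j)

interval-below : ∀ {i j c} → c < i → interval i j c ≡ false
interval-below c<i rewrite ≤ᵇ-false c<i = refl

interval-inside : ∀ {i j c} → i ≤ c → c ≤ j → interval i j c ≡ true
interval-inside i≤c c≤j rewrite ≤ᵇ-true i≤c | ≤ᵇ-true c≤j = refl

interval-above : ∀ {i j c} → j < c → interval i j c ≡ false
interval-above {i} {j} {c} j<c rewrite ≤ᵇ-false j<c = ∧-zeroʳ (i ≤ᵇ c)

jump-interval : ∀ i' j d → i' < j → b2n (jump (interval (suc i') j) d) ≡ b2n (d ≡ᵇ i') + b2n (d ≡ᵇ j)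
jump-interval i' j d i'<j with <-cmp d i'
... | tri< d<i' _ _
  rewrite interval-below {suc i'} {j} (s≤s d<i') | interval-below {suc i'} {j} (m≤n⇒m≤1+n d<i')
        | ≡ᵇ-false (<⇒≢ d<i') | ≡ᵇ-false (<⇒≢ (<-trans d<i' i'<j)) = refl
... | tri≈ _ refl _
  rewrite interval-inside {suc d} {j} ≤-refl i'<j | interval-below {suc d} {j} (n<1+n d)
        | ≡ᵇ-true d | ≡ᵇ-false (<⇒≢ i'<j) = refl
... | tri> _ _ i'<d with <-cmp d j
...   | tri< d<j _ _
  rewrite interval-inside {suc i'} {j} (m≤n⇒m≤1+n i'<d) d<j | interval-inside {suc i'} {j} i'<d (<⇒≤ d<j)
        | ≡ᵇ-false (>⇒≢ i'<d) | ≡ᵇ-false (<⇒≢ d<j) = refl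
...   | tri≈ _ refl _
  rewrite interval-above {suc i'} {d} (n<1+n d) | interval-inside {suc i'} {d} i'<d ≤-refl
        | ≡ᵇ-false (>⇒≢ i'<d) | ≡ᵇ-true d = refl
...   | tri> _ _ j<d
  rewrite interval-above {suc i'} {j} (m≤n⇒m≤1+n j<d) | interval-above {suc i'} {j} j<d
        | ≡ᵇ-false (>⇒≢ i'<d) | ≡ᵇ-false (>⇒≢ j<d) = refl

interval-jumps : ∀ t i j → 1 ≤ i → i ≤ j → j ≤ t → jumps 0 (suc t) (interval i j) ≡ 2
interval-jumps t (suc i') j _ i≤j j≤t = begin
  jumps 0 (suc t) (interval (suc i') j)
    ≡⟨ sumℕ-cong 0 (suc t) (λ d → jump-interval i' j d i≤j) ⟩
  sumℕ 0 (suc t) (λ d → b2n (d ≡ᵇ i') + b2n (d ≡ᵇ j))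
    ≡⟨ sumℕ-+ 0 (suc t) (λ d → b2n (d ≡ᵇ i')) (λ d → b2n (d ≡ᵇ j)) ⟩
  sumℕ 0 (suc t) (λ d → b2n (d ≡ᵇ i')) + sumℕ 0 (suc t) (λ d → b2n (d ≡ᵇ j))
    ≡⟨ cong₂ _+_ (indicator-inside 0 (suc t) i' z≤n (≤-trans i≤j (m≤n⇒m≤1+n j≤t)))
                 (indicator-inside 0 (suc t) j z≤n (s≤s j≤t)) ⟩
  2 ∎

jumps-empty : ∀ a n → jumps a n (λ _ → false) ≡ 0
jumps-empty a zero    = refl
jumps-empty a (suc n) = jumps-empty (suc a) n

jump-∪ : ∀ (A B : ℕ → Bool) d → (A d ≡ false × A (suc d) ≡ false) ⊎ (B d ≡ false × B (suc d) ≡ false) →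
         b2n (jump (λ c → A c ∨ B c) d) ≡ b2n (jump A d) + b2n (jump B d)
jump-∪ A B d (inj₁ (Ad≡false , Ad+1≡false)) rewrite Ad≡false | Ad+1≡false = refl
jump-∪ A B d (inj₂ (Bd≡false , Bd+1≡false))
  rewrite Bd≡false | Bd+1≡false | ∨-identityʳ (A d) | ∨-identityʳ (A (suc d)) = sym (+-identityʳ _)

xor-false : ∀ b → b xor false ≡ b
xor-false true  = refl
xor-false false = refl

jumps-ends : ∀ t' A → A 0 ≡ false → A (suc (suc t')) ≡ false →
             jumps 0 (suc (suc t')) A ≡ b2n (A 1) + (jumps 1 t' A + b2n (A (suc t')))
jumps-ends t' A A0≡false At+1≡false = cong₂ _+_ first last
  where
  first : b2n (A 1 xor A 0) ≡ b2n (A 1)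
  first = cong b2n (trans (cong (A 1 xor_) A0≡false) (xor-false (A 1)))
  last : jumps 1 (suc t') A ≡ jumps 1 t' A + b2n (A (suc t'))
  last = trans (sumℕ-snoc 1 t' (λ d → b2n (jump A d)))
               (cong (λ b → jumps 1 t' A + b2n (b xor A (suc t'))) At+1≡false)

module SeparatedIntervals (t ρ : ℕ) (i j : ℕ → ℕ) (P : IntervalPartition t ρ i j) where

  bounds : ∀ k → 1 ≤ k → k ≤ ρ → 1 ≤ i k × i k ≤ j k × j k ≤ t
  bounds = proj₁ P

  gap : ∀ k → 1 ≤ k → k < ρ → j k + 2 ≤ i (suc k)
  gap = proj₂ P

  next : ℕ → ℕ → Bool
  next r = interval (i (suc r)) (j (suc r))

  union-below : ∀ r → r < ρ → ∀ c → i (suc r) ≤ suc c → inIntervals r i j c ≡ false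
  union-below zero    _     c _ = refl
  union-below (suc r) r+1<ρ c i≤c+1 =
    cong₂ _∨_ (union-below r (<⇒≤ r+1<ρ) c (≤-trans i≤j (≤-trans (m≤m+n _ 2) j+2≤c+1)))
              (interval-above {i (suc r)} (≤-pred (subst (_≤ suc c) (+-comm (j (suc r)) 2) j+2≤c+1)))
    where
    i≤j : i (suc r) ≤ j (suc r)
    i≤j = proj₁ (proj₂ (bounds (suc r) z<s (<⇒≤ r+1<ρ)))
    j+2≤c+1 : j (suc r) + 2 ≤ suc c
    j+2≤c+1 = ≤-trans (gap (suc r) z<s r+1<ρ) i≤c+1

  separated : ∀ r → r < ρ → ∀ d →
              (inIntervals r i j d ≡ false × inIntervals r i j (suc d) ≡ false) ⊎
              (next r d ≡ false × next r (suc d) ≡ false)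
  separated r r<ρ d with suc d <? i (suc r)
  ... | yes d+1<i = inj₂ (interval-below {j = j (suc r)} (<-trans (n<1+n d) d+1<i) , interval-below {j = j (suc r)} d+1<i)
  ... | no  d+1≮i = inj₁ (union-below r r<ρ d i≤d+1 , union-below r r<ρ (suc d) (m≤n⇒m≤1+n i≤d+1))
    where
    i≤d+1 : i (suc r) ≤ suc d
    i≤d+1 = ≮⇒≥ d+1≮i

  union-outside : ∀ r → r ≤ ρ → ∀ c → c < 1 ⊎ t < c → inIntervals r i j c ≡ false
  union-outside zero    _   c _       = refl
  union-outside (suc r) r<ρ c outside =
    cong₂ _∨_ (union-outside r (<⇒≤ r<ρ) c outside) (outside-next outside)
    where
    bounds-r : 1 ≤ i (suc r) × i (suc r) ≤ j (suc r) × j (suc r) ≤ t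
    bounds-r = bounds (suc r) z<s r<ρ
    outside-next : c < 1 ⊎ t < c → next r c ≡ false
    outside-next (inj₁ c<1) = interval-below (<-≤-trans c<1 (proj₁ bounds-r))
    outside-next (inj₂ t<c) = interval-above {i (suc r)} (≤-<-trans (proj₂ (proj₂ bounds-r)) t<c)

  -- Each interval contributes two changes, and separated pieces do not interact.
  union-jumps : ∀ r → r ≤ ρ → jumps 0 (suc t) (inIntervals r i j) ≡ 2 * r
  union-jumps zero    _   = jumps-empty 0 (suc t)
  union-jumps (suc r) r<ρ = begin
    jumps 0 (suc t) (inIntervals (suc r) i j)
      ≡⟨ sumℕ-cong 0 (suc t) (λ d → jump-∪ (inIntervals r i j) (next r) d (separated r r<ρ d)) ⟩
    sumℕ 0 (suc t) (λ d → b2n (jump (inIntervals r i j) d) + b2n (jump (next r) d))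
      ≡⟨ sumℕ-+ 0 (suc t) (λ d → b2n (jump (inIntervals r i j) d)) (λ d → b2n (jump (next r) d)) ⟩
    jumps 0 (suc t) (inIntervals r i j) + jumps 0 (suc t) (next r)
      ≡⟨ cong₂ _+_ (union-jumps r (<⇒≤ r<ρ)) (interval-jumps t _ _ i≥1 i≤j j≤t) ⟩
    2 * r + 2
      ≡⟨ trans (+-comm (2 * r) 2) (sym (*-suc 2 r)) ⟩
    2 * suc r ∎
    where
    i≥1 : 1 ≤ i (suc r)
    i≥1 = proj₁ (bounds (suc r) z<s r<ρ)
    i≤j : i (suc r) ≤ j (suc r)
    i≤j = proj₁ (proj₂ (bounds (suc r) z<s r<ρ))
    j≤t : j (suc r) ≤ t
    j≤t = proj₂ (proj₂ (bounds (suc r) z<s r<ρ))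

Qcount : ℕ → (ℕ → Bool) → ℕ
Qcount t A = countNZ 1 t (solution A t)

-- x_1 is nonzero exactly when A meets {1, t} in ∅ or in {1, t}; these are the end corrections.
ends-meet : ∀ a b n → (a ≡ true ⊎ b ≡ true) → suc (b2n (not (a xor b)) + n) ≡ b2n a + (n + b2n b)
ends-meet true  true  n _ = cong suc (+-comm 1 n)
ends-meet true  false n _ = cong suc (sym (+-identityʳ n))
ends-meet false true  n _ = +-comm 1 n
ends-meet false false n (inj₁ ())
ends-meet false false n (inj₂ ())

ends-avoid : ∀ a b n → ¬ (a ≡ true ⊎ b ≡ true) → b2n (not (a xor b)) + n ≡ suc (b2n a + (n + b2n b))
ends-avoid false false n _     = cong suc (sym (+-identityʳ n))
ends-avoid true  b     n avoid = ⊥-elim (avoid (inj₁ refl))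
ends-avoid false true  n avoid = ⊥-elim (avoid (inj₂ refl))

changes-split : ∀ {t' ρ i j} → IntervalPartition (suc t') ρ i j →
                2 * ρ ≡ b2n (inIntervals ρ i j 1) + (jumps 1 t' (inIntervals ρ i j) + b2n (inIntervals ρ i j (suc t')))
changes-split {t'} {ρ} {i} {j} P =
  trans (sym (union-jumps ρ ≤-refl))
        (jumps-ends t' (inIntervals ρ i j) (union-outside ρ ≤-refl 0 (inj₁ z<s))
                                           (union-outside ρ ≤-refl (suc (suc t')) (inj₂ ≤-refl)))
  where open SeparatedIntervals (suc t') ρ i j P

odd-below : ∀ q ρ → suc q ≡ 2 * ρ → q ≡ suc (2 * (ρ ∸ 1))
odd-below q (suc r) q+1≡2ρ = suc-injective (trans q+1≡2ρ (*-suc 2 r))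

Qcount-meeting : ∀ {t' ρ i j} → IntervalPartition (suc t') ρ i j → meetsEnds (suc t') (inIntervals ρ i j) →
                 Qcount (suc t') (inIntervals ρ i j) ≡ suc (2 * (ρ ∸ 1))
Qcount-meeting {t'} {ρ} {i} {j} P meets =
  odd-below _ ρ (trans (cong suc (nonzeros-solution A t'))
                       (trans (ends-meet (A 1) (A (suc t')) (jumps 1 t' A) meets) (sym (changes-split P))))
  where
  A : ℕ → Bool
  A = inIntervals ρ i j

Qcount-avoiding : ∀ {t' ρ i j} → IntervalPartition (suc t') ρ i j → ¬ meetsEnds (suc t') (inIntervals ρ i j) →
                  Qcount (suc t') (inIntervals ρ i j) ≡ suc (2 * ρ)
Qcount-avoiding {t'} {ρ} {i} {j} P avoids =
  trans (nonzeros-solution A t')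
        (trans (ends-avoid (A 1) (A (suc t')) (jumps 1 t' A) avoids) (cong suc (sym (changes-split P))))
  where
  A : ℕ → Bool
  A = inIntervals ρ i j

odd-counts : ∀ {p q m n} → p ≡ suc (2 * m) → q ≡ suc (2 * n) → (p ≡ q ⇔ n ≡ m)
odd-counts {m = m} {n} refl refl =
  mk⇔ (λ e → sym (*-cancelˡ-≡ m n 2 (suc-injective e))) (λ e → cong (λ k → suc (2 * k)) (sym e))

suc-⇔ : ∀ {m n} → m ≡ n ⇔ suc m ≡ suc n
suc-⇔ = mk⇔ (cong suc) suc-injective

mainTheorem5 : (t : ℕ) → 3 ≤ t →
    (ρA : ℕ) (iA jA : ℕ → ℕ) → 1 ≤ ρA → IntervalPartition t ρA iA jA →
    (ρB : ℕ) (iB jB : ℕ → ℕ) → 1 ≤ ρB → IntervalPartition t ρB iB jB →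
    Σ ℕ λ qA → Σ ℕ λ qB →
      QSize t (negOn (inIntervals ρA iA jA) Tplus) qA ×
      QSize t (negOn (inIntervals ρB iB jB) Tplus) qB ×
      (((meetsEnds t (inIntervals ρA iA jA) × meetsEnds t (inIntervals ρB iB jB))
          ⊎ (¬ meetsEnds t (inIntervals ρA iA jA) × ¬ meetsEnds t (inIntervals ρB iB jB)))
        → (qA ≡ qB ⇔ ρB ≡ ρA)) ×
      ((meetsEnds t (inIntervals ρA iA jA) × ¬ meetsEnds t (inIntervals ρB iB jB))
        → (qA ≡ qB ⇔ ρB ≡ ρA ∸ 1))
mainTheorem5 (suc t') _ (suc a) iA jA (s≤s z≤n) PA (suc b) iB jB (s≤s z≤n) PB =
  Qcount t A , Qcount t B ,
  (solution A t , solution-solves A t , refl) ,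
  (solution B t , solution-solves B t , refl) ,
  (λ { (inj₁ (meetsA , meetsB)) →
         ⇔.trans (odd-counts (Qcount-meeting PA meetsA) (Qcount-meeting PB meetsB)) suc-⇔
     ; (inj₂ (avoidsA , avoidsB)) →
         odd-counts (Qcount-avoiding PA avoidsA) (Qcount-avoiding PB avoidsB) }) ,
  (λ (meetsA , avoidsB) → odd-counts (Qcount-meeting PA meetsA) (Qcount-avoiding PB avoidsB))
  where
  t : ℕ
  t = suc t'
  A B : ℕ → Bool
  A = inIntervals (suc a) iA jA
  B = inIntervals (suc b) iB jB
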